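{- Let $1\le m\le l<k\le n-2$, and let $\Gamma$ be a simple connected graph with $n$ vertices containing distinct vertices $y,x_1,\dots,x_l,v,u_1,\dots,u_m$ and the edges $yx_1$, $x_jx_{j+1}$ ($1\le j\le l-1$), $x_lv$, $x_1u_1$ and $u_ju_{j+1}$ ($1\le j\le m-1$). If $V_k$ is a set of $k$ vertices of $\Gamma$ such that $y,x_1,\dots,x_l\in V_k$, and $v,u_i\notin V_k$ for some $1\le i\le m$, then the defect $k$ group $G_{k,V_k}$ of $\Gamma$ contains the transposition $(u_i,v)$.
   Context: For a finite simple undirected graph $\Gamma=(V,E)$, the flow semigroup $S_\Gamma$ is the semigroup of transformations of $V$ (acting on the right) generated by the elementary collapsings $e_{uv}$ and $e_{vu}$ for all edges $uv\in E$, where $e_{uv}$ maps $u$ to $v$ and fixes every other vertex. For $1\le k\le |V|-1$ and $V_k\subseteq V$ with $|V_k|=k$, the defect $k$ group $G_{k,V_k}$ is the permutation group on $V\setminus V_k$ generated by the restrictions $s|_{V\setminus V_k}$ of all $s\in S_\Gamma$ with $(V\setminus V_k)s=V\setminus V_k$ and $V_k s\subseteq V\setminus V_k$. -}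

module Defs where

open import Data.Nat using (ℕ; zero; suc; _+_; _≤_; _<_; _∸_)
open import Data.Fin using (Fin; _≟_)
open import Data.Fin.Subset using (Subset; _∈_; _∉_; ∁; ∣_∣)
open import Data.Product using (Σ; _×_; ∃; _,_)
open import Relation.Nullary using (¬_; does)
open import Data.Bool using (if_then_else_)
open import Relation.Binary.PropositionalEquality using (_≡_; _≢_)
open import Level using (0ℓ)

Rel : ℕ → Set₁
Rel n = Fin n → Fin n → Set

record IsSimpleGraph {n : ℕ} (E : Rel n) : Set where
  field
    sym   : ∀ {a b} → E a b → E b a
    irrefl : ∀ {a} → ¬ E a a

data Path {n : ℕ} (E : Rel n) : Fin n → Fin n → Set where
  here : ∀ {a} → Path E a a
  step : ∀ {a b c} → E a b → Path E b c → Path E a c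

Connected : {n : ℕ} → Rel n → Set
Connected E = ∀ a b → Path E a b

collapse : {n : ℕ} → Fin n → Fin n → Fin n → Fin n
collapse a b z = if does (z ≟ a) then b else z

transposition : {n : ℕ} → Fin n → Fin n → Fin n → Fin n
transposition a b z = if does (z ≟ a) then b else (if does (z ≟ b) then a else z)

-- Membership in the flow semigroup S_Γ (transformations acting on the right,
-- so x(st) = (xs)t; maps compared pointwise).
data InFlow {n : ℕ} (E : Rel n) : (Fin n → Fin n) → Set where
  gen  : ∀ {a b s} → E a b → (∀ z → s z ≡ collapse a b z) → InFlow E s
  gen′ : ∀ {a b s} → E a b → (∀ z → s z ≡ collapse b a z) → InFlow E s
  comp : ∀ {s t r} → InFlow E s → InFlow E t → (∀ z → r z ≡ t (s z)) → InFlow E r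

IsDefectGenerator : {n : ℕ} → Rel n → Subset n → (Fin n → Fin n) → Set
IsDefectGenerator E Vk s =
  InFlow E s
  × (∀ z → z ∈ ∁ Vk → s z ∈ ∁ Vk)
  × (∀ w → w ∈ ∁ Vk → ∃ λ z → z ∈ ∁ Vk × s z ≡ w)
  × (∀ z → z ∈ Vk → s z ∈ ∁ Vk)

-- An element is
-- represented by a map Fin n → Fin n, only its restriction to V∖V_k matters.
data InDefectGroup {n : ℕ} (E : Rel n) (Vk : Subset n) : (Fin n → Fin n) → Set where
  gen  : ∀ {f s} → IsDefectGenerator E Vk s
         → (∀ z → z ∈ ∁ Vk → f z ≡ s z) → InDefectGroup E Vk f
  one  : ∀ {f} → (∀ z → z ∈ ∁ Vk → f z ≡ z) → InDefectGroup E Vk f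
  comp : ∀ {g h f} → InDefectGroup E Vk g → InDefectGroup E Vk h
         → (∀ z → z ∈ ∁ Vk → f z ≡ h (g z)) → InDefectGroup E Vk f
  inv  : ∀ {g f} → InDefectGroup E Vk g
         → (∀ z → z ∈ ∁ Vk → f z ∈ ∁ Vk) → (∀ z → z ∈ ∁ Vk → g (f z) ≡ z)
         → InDefectGroup E Vk f

-- Think of the vertices outside V_k as tokens and of those in V_k as free room: an element of the
-- flow semigroup first pushes every vertex into V∖V_k along a walk, after which only its action on
-- V∖V_k matters.  On the path u_i, …, u_1, x_1, …, x_l, v the vertices x_1, …, x_l and the pendant
-- vertex y give l + 1 ≥ i + 1 free places: this is room enough to park the token of v at y, shift
-- the block u_i, …, u_1 past x_1, exchange the two end tokens through y, and shift the block back.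
-- Each move is a power of a slide along a path, a product of elementary collapsings, and the
-- composite acts on V∖V_k as the transposition (u_i v).
module Submission where

open import Defs
open import Data.Nat using (ℕ; _+_; _≤_; _<_)
open import Data.Fin using (Fin)
open import Data.Fin.Subset using (Subset; _∈_; _∉_; ∣_∣)
open import Relation.Binary.PropositionalEquality using (_≡_; _≢_)
open import Data.Product using (_×_)

open import Data.Nat using (zero; suc; _∸_; s≤s; z≤n; _<?_)
open import Data.Nat.Properties hiding (_≟_)
open import Data.Fin using (_≟_)
open import Data.Fin.Subset using (∁)
open import Data.Fin.Subset.Properties using (_∈?_; x∈∁p⇒x∉p; x∉p⇒x∈∁p)
open import Data.List using (List; []; _∷_; allFin)
open import Data.List.Relation.Unary.Any using (here; there)
open import Data.List.Membership.Propositional using () renaming (_∈_ to _∈ₗ_)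
open import Data.List.Membership.Propositional.Properties using (∈-allFin)
open import Data.Product using (∃; _,_; proj₁; proj₂)
open import Data.Sum using (_⊎_; inj₁; inj₂)
open import Data.Empty using (⊥-elim)
open import Function using (id; _∘_)
open import Relation.Binary.Definitions using (Symmetric)
open import Relation.Binary.PropositionalEquality using (refl; sym; trans; cong; subst; subst₂; module ≡-Reasoning)
open import Relation.Nullary using (yes; no)
open import Relation.Nullary.Decidable using (dec-true; dec-false)

collapse-source : ∀ {n} (a b : Fin n) → collapse a b a ≡ b
collapse-source a b rewrite dec-true (a ≟ a) refl = refl

collapse-≢ : ∀ {n} {a z : Fin n} (b : Fin n) → z ≢ a → collapse a b z ≡ z
collapse-≢ {a = a} {z} b z≢a rewrite dec-false (z ≟ a) z≢a = refl

transposition-left : ∀ {n} (a b : Fin n) → transposition a b a ≡ b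
transposition-left a b rewrite dec-true (a ≟ a) refl = refl

transposition-right : ∀ {n} (a b : Fin n) → transposition a b b ≡ a
transposition-right a b with b ≟ a
... | yes b≡a = b≡a
... | no _ rewrite dec-true (b ≟ b) refl = refl

transposition-≢ : ∀ {n} {a b w : Fin n} → w ≢ a → w ≢ b → transposition a b w ≡ w
transposition-≢ {a = a} {b} {w} w≢a w≢b
  rewrite dec-false (w ≟ a) w≢a | dec-false (w ≟ b) w≢b = refl

transposition-elim : ∀ {n} {a b : Fin n} (P : Fin n → Fin n → Set)
  → P a b → P b a → (∀ {w} → w ≢ a → w ≢ b → P w w)
  → ∀ w → P w (transposition a b w)
transposition-elim {a = a} {b} P pab pba pww w with w ≟ a | w ≟ b
... | yes refl | _ = pab
... | no _ | yes refl = pba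
... | no w≢a | no w≢b = pww w≢a w≢b

transposition-involutive : ∀ {n} (a b w : Fin n) → transposition a b (transposition a b w) ≡ w
transposition-involutive a b = transposition-elim (λ w t → transposition a b t ≡ w)
  (transposition-right a b) (transposition-left a b) transposition-≢

transposition-closed : ∀ {n} {a b : Fin n} (T : Subset n) → a ∈ T → b ∈ T
  → ∀ w → w ∈ T → transposition a b w ∈ T
transposition-closed T a∈T b∈T = transposition-elim (λ w t → w ∈ T → t ∈ T)
  (λ _ → b∈T) (λ _ → a∈T) (λ _ _ → id)

InFlow¹ : ∀ {n} → Rel n → (Fin n → Fin n) → Set
InFlow¹ E s = InFlow E s ⊎ (∀ z → s z ≡ z)

module _ {n : ℕ} where

  open import Function.Endo.Propositional (Fin n) using (_^_)

  module _ {E : Rel n} where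

    InFlow-resp : ∀ {s r} → InFlow E s → (∀ z → r z ≡ s z) → InFlow E r
    InFlow-resp (gen e s≗) r≗s = gen e (λ z → trans (r≗s z) (s≗ z))
    InFlow-resp (gen′ e s≗) r≗s = gen′ e (λ z → trans (r≗s z) (s≗ z))
    InFlow-resp (comp s t s≗) r≗s = comp s t (λ z → trans (r≗s z) (s≗ z))

    InFlow¹-id : InFlow¹ E id
    InFlow¹-id = inj₂ (λ _ → refl)

    InFlow¹-collapse : ∀ {a b} → E a b → InFlow¹ E (collapse a b)
    InFlow¹-collapse e = inj₁ (gen e (λ _ → refl))

    InFlow-∘¹ : ∀ {s t} → InFlow¹ E s → InFlow E t → InFlow E (t ∘ s)
    InFlow-∘¹ (inj₁ s∈) t∈ = comp s∈ t∈ (λ _ → refl)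
    InFlow-∘¹ {t = t} (inj₂ s≗id) t∈ = InFlow-resp t∈ (λ z → cong t (s≗id z))

    InFlow¹-∘ : ∀ {s t} → InFlow¹ E s → InFlow¹ E t → InFlow¹ E (t ∘ s)
    InFlow¹-∘ s∈ (inj₁ t∈) = inj₁ (InFlow-∘¹ s∈ t∈)
    InFlow¹-∘ {s} (inj₁ s∈) (inj₂ t≗id) = inj₁ (InFlow-resp s∈ (λ z → t≗id (s z)))
    InFlow¹-∘ {s} (inj₂ s≗id) (inj₂ t≗id) = inj₂ (λ z → trans (t≗id (s z)) (s≗id z))

    InFlow¹-^ : ∀ {g} → InFlow¹ E g → ∀ k → InFlow¹ E (g ^ k)
    InFlow¹-^ g∈ zero = InFlow¹-id
    InFlow¹-^ g∈ (suc k) = InFlow¹-∘ (InFlow¹-^ g∈ k) g∈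

  IsWalk : Rel n → (ℕ → Fin n) → ℕ → Set
  IsWalk E f r = ∀ j → j < r → E (f j) (f (suc j))

  Distinct : (ℕ → Fin n) → ℕ → Set
  Distinct f r = ∀ {a b} → a ≤ r → b ≤ r → f a ≡ f b → a ≡ b

  record IsPath (E : Rel n) (f : ℕ → Fin n) (r : ℕ) : Set where
    field
      walk : IsWalk E f r
      distinct : Distinct f r

  open IsPath

  reverse : (ℕ → Fin n) → ℕ → ℕ → Fin n
  reverse f r q = f (r ∸ q)

  drop : ℕ → (ℕ → Fin n) → ℕ → Fin n
  drop s f q = f (s + q)

  prepend : Fin n → (ℕ → Fin n) → ℕ → Fin n
  prepend a f zero = a
  prepend a f (suc q) = f q

  Distinct-≤ : ∀ {f r r′} → Distinct f r → r′ ≤ r → Distinct f r′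
  Distinct-≤ f-distinct r′≤r a≤ b≤ = f-distinct (≤-trans a≤ r′≤r) (≤-trans b≤ r′≤r)

  Distinct-reverse : ∀ {f r} → Distinct f r → Distinct (reverse f r) r
  Distinct-reverse {r = r} f-distinct {a} {b} a≤ b≤ eq =
    ∸-cancelˡ-≡ a≤ b≤ (f-distinct (m∸n≤m r a) (m∸n≤m r b) eq)

  module _ {E : Rel n} where

    IsPath-≤ : ∀ {f r r′} → IsPath E f r → r′ ≤ r → IsPath E f r′
    IsPath-≤ p r′≤r = record
      { walk = λ j j< → walk p j (<-≤-trans j< r′≤r)
      ; distinct = Distinct-≤ (distinct p) r′≤r
      }

    IsPath-reverse : Symmetric E → ∀ {f r} → IsPath E f r → IsPath E (reverse f r) r
    IsPath-reverse E-sym {f} {r} p = record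
      { walk = λ j j<r → let r∸j≡1+r∸1+j = +-∸-assoc 1 j<r in
          subst (λ q → E (f q) (f (r ∸ suc j))) (sym r∸j≡1+r∸1+j)
            (E-sym (walk p (r ∸ suc j) (subst (_≤ r) r∸j≡1+r∸1+j (m∸n≤m r j))))
      ; distinct = Distinct-reverse (distinct p)
      }

    IsPath-drop : ∀ {f} s {r} → IsPath E f (s + r) → IsPath E (drop s f) r
    IsPath-drop {f} s p = record
      { walk = λ j j<r → subst (E (f (s + j)) ∘ f) (sym (+-suc s j)) (walk p (s + j) (+-monoʳ-< s j<r))
      ; distinct = λ a≤ b≤ eq → +-cancelˡ-≡ s _ _ (distinct p (+-monoʳ-≤ s a≤) (+-monoʳ-≤ s b≤) eq)
      }

    IsPath-prepend : ∀ {a f r} → E a (f 0) → (∀ j → j ≤ r → a ≢ f j) → IsPath E f r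
      → IsPath E (prepend a f) (suc r)
    IsPath-prepend {a} {f} {r} e a∉f p = record { walk = walk′ ; distinct = distinct′ }
      where
      walk′ : IsWalk E (prepend a f) (suc r)
      walk′ zero _ = e
      walk′ (suc j) (s≤s j<r) = walk p j j<r
      distinct′ : Distinct (prepend a f) (suc r)
      distinct′ {zero} {zero} _ _ _ = refl
      distinct′ {zero} {suc b} _ (s≤s b≤r) eq = ⊥-elim (a∉f b b≤r eq)
      distinct′ {suc a} {zero} (s≤s a≤r) _ eq = ⊥-elim (a∉f a a≤r (sym eq))
      distinct′ {suc a} {suc b} (s≤s a≤r) (s≤s b≤r) eq = cong suc (distinct p a≤r b≤r eq)

  -- Collapsing from the far end backwards, every f j with j < r advances exactly one step.
  slide : (ℕ → Fin n) → ℕ → Fin n → Fin n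
  slide f zero = id
  slide f (suc r) = slide f r ∘ collapse (f r) (f (suc r))

  slide-InFlow¹ : ∀ {E f r} → IsWalk E f r → InFlow¹ E (slide f r)
  slide-InFlow¹ {r = zero} _ = InFlow¹-id
  slide-InFlow¹ {r = suc r} f-walk =
    InFlow¹-∘ (InFlow¹-collapse (f-walk r ≤-refl)) (slide-InFlow¹ (λ j j<r → f-walk j (m<n⇒m<1+n j<r)))

  slide-fixes : ∀ {f} r {z} → (∀ j → j < r → z ≢ f j) → slide f r z ≡ z
  slide-fixes zero _ = refl
  slide-fixes {f} (suc r) {z} z∉f = begin
    slide f r (collapse (f r) (f (suc r)) z) ≡⟨ cong (slide f r) (collapse-≢ (f (suc r)) (z∉f r ≤-refl)) ⟩
    slide f r z                              ≡⟨ slide-fixes r (λ j j<r → z∉f j (m<n⇒m<1+n j<r)) ⟩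
    z                                        ∎
    where open ≡-Reasoning

  slide-advances : ∀ {f r j} → Distinct f r → j < r → slide f r (f j) ≡ f (suc j)
  slide-advances {f} {suc r} {j} f-distinct (s≤s j≤r) with m≤n⇒m<n∨m≡n j≤r
  ... | inj₁ j<r = begin
    slide f r (collapse (f r) (f (suc r)) (f j)) ≡⟨ cong (slide f r) (collapse-≢ (f (suc r)) fj≢fr) ⟩
    slide f r (f j)                              ≡⟨ slide-advances (Distinct-≤ f-distinct (n≤1+n r)) j<r ⟩
    f (suc j)                                    ∎
    where
    open ≡-Reasoning
    fj≢fr : f j ≢ f r
    fj≢fr eq = <-irrefl (f-distinct (m≤n⇒m≤1+n j≤r) (n≤1+n r) eq) j<r
  ... | inj₂ refl = begin
    slide f j (collapse (f j) (f (suc j)) (f j)) ≡⟨ cong (slide f j) (collapse-source (f j) (f (suc j))) ⟩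
    slide f j (f (suc j))                        ≡⟨ slide-fixes j fsj∉ ⟩
    f (suc j)                                    ∎
    where
    open ≡-Reasoning
    fsj∉ : ∀ i → i < j → f (suc j) ≢ f i
    fsj∉ i i<j eq = <-irrefl (sym (f-distinct ≤-refl (<⇒≤ (m<n⇒m<1+n i<j)) eq)) (m<n⇒m<1+n i<j)

  slide^-fixes : ∀ {f} r {z} → (∀ j → j < r → z ≢ f j) → ∀ k → (slide f r ^ k) z ≡ z
  slide^-fixes r z∉f zero = refl
  slide^-fixes {f} r z∉f (suc k) = trans (cong (slide f r) (slide^-fixes r z∉f k)) (slide-fixes r z∉f)

  slide^-advances : ∀ {f r} → Distinct f r → ∀ p k → p + k ≤ r → (slide f r ^ k) (f p) ≡ f (p + k)
  slide^-advances {f} f-distinct p zero _ = cong f (sym (+-identityʳ p))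
  slide^-advances {f} {r} f-distinct p (suc k) p+1+k≤r = begin
    slide f r ((slide f r ^ k) (f p)) ≡⟨ cong (slide f r) (slide^-advances f-distinct p k (<⇒≤ p+k<r)) ⟩
    slide f r (f (p + k))             ≡⟨ slide-advances f-distinct p+k<r ⟩
    f (suc (p + k))                   ≡⟨ cong f (sym (+-suc p k)) ⟩
    f (p + suc k)                     ∎
    where
    open ≡-Reasoning
    p+k<r : p + k < r
    p+k<r = subst (_≤ r) (+-suc p k) p+1+k≤r

  slide^-reverse-fixes : ∀ {f} r {z} → (∀ j → 0 < j → j ≤ r → z ≢ f j)
    → ∀ k → (slide (reverse f r) r ^ k) z ≡ z
  slide^-reverse-fixes r z∉f = slide^-fixes r (λ j j<r → z∉f (r ∸ j) (m<n⇒0<n∸m j<r) (m∸n≤m r j))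

  slide^-reverse-retreats : ∀ {f r} → Distinct f r → ∀ p k → p + k ≤ r
    → (slide (reverse f r) r ^ k) (f (p + k)) ≡ f p
  slide^-reverse-retreats {f} {r} f-distinct p k p+k≤r = begin
    (slide (reverse f r) r ^ k) (f (p + k))
      ≡⟨ cong (λ a → (slide (reverse f r) r ^ k) (f a)) (sym (m∸[m∸n]≡n p+k≤r)) ⟩
    (slide (reverse f r) r ^ k) (reverse f r q)
      ≡⟨ slide^-advances (Distinct-reverse f-distinct) q k q+k≤r ⟩
    f (r ∸ (q + k))
      ≡⟨ cong f r∸[q+k]≡p ⟩
    f p ∎
    where
    open ≡-Reasoning
    q : ℕ
    q = r ∸ (p + k)
    q+k≡r∸p : q + k ≡ r ∸ p
    q+k≡r∸p = begin
      r ∸ (p + k) + k ≡⟨ cong (_+ k) (sym (∸-+-assoc r p k)) ⟩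
      r ∸ p ∸ k + k   ≡⟨ m∸n+n≡m (m+n≤o⇒m≤o∸n k (subst (_≤ r) (+-comm p k) p+k≤r)) ⟩
      r ∸ p           ∎
    q+k≤r : q + k ≤ r
    q+k≤r = subst (_≤ r) (sym q+k≡r∸p) (m∸n≤m r p)
    r∸[q+k]≡p : r ∸ (q + k) ≡ p
    r∸[q+k]≡p = trans (cong (r ∸_) q+k≡r∸p) (m∸[m∸n]≡n (≤-trans (m≤m+n p k) p+k≤r))

  record Retraction (E : Rel n) (T : Subset n) (P : Fin n → Set) : Set where
    field
      map : Fin n → Fin n
      flow : InFlow¹ E map
      fixes : ∀ z → z ∈ T → map z ≡ z
      into : ∀ z → P z → map z ∈ T

  module _ {E : Rel n} {T : Subset n} where

    id-retraction : ∀ {P} → (∀ z → P z → z ∈ T) → Retraction E T P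
    id-retraction P⊆T = record { map = id ; flow = InFlow¹-id ; fixes = λ _ _ → refl ; into = P⊆T }

    retract-along : ∀ {w t} → Path E w t → t ∈ T → Retraction E T (_≡ w)
    retract-along here t∈T = id-retraction (λ { _ refl → t∈T })
    retract-along {w} (step {b = b} e p) t∈T with w ∈? T
    ... | yes w∈T = id-retraction (λ { _ refl → w∈T })
    ... | no w∉T = record
      { map = map ∘ collapse w b
      ; flow = InFlow¹-∘ (InFlow¹-collapse e) flow
      ; fixes = λ z z∈T → trans (cong map (collapse-≢ b (λ { refl → w∉T z∈T }))) (fixes z z∈T)
      ; into = λ { _ refl → subst (_∈ T) (sym (cong map (collapse-source w b))) (into b refl) }
      }
      where open Retraction (retract-along p t∈T)

    retract-list : Connected E → ∀ {t} → t ∈ T → (zs : List (Fin n)) → Retraction E T (_∈ₗ zs)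
    retract-list conn t∈T [] = id-retraction (λ _ ())
    retract-list conn {t} t∈T (w ∷ zs) = record
      { map = h.map ∘ g.map
      ; flow = InFlow¹-∘ g.flow h.flow
      ; fixes = λ z z∈T → trans (cong h.map (g.fixes z z∈T)) (h.fixes z z∈T)
      ; into = into
      }
      where
      module g = Retraction (retract-list conn t∈T zs)
      module h = Retraction (retract-along (conn (g.map w) t) t∈T)
      into : ∀ z → z ∈ₗ w ∷ zs → h.map (g.map z) ∈ T
      into _ (here refl) = h.into _ refl
      into z (there z∈zs) = subst (_∈ T) (sym (h.fixes _ (g.into z z∈zs))) (g.into z z∈zs)

  involution∈DefectGroup : ∀ {E S c c′ t π d} → Connected E → E c c′ → c ∈ S → t ∈ ∁ S
    → (∀ z → z ∈ ∁ S → π z ∈ ∁ S) → (∀ z → z ∈ ∁ S → π (π z) ≡ z)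
    → InFlow¹ E d → (∀ z → z ∈ ∁ S → d z ≡ π z)
    → InDefectGroup E S π
  involution∈DefectGroup {E} {S} {c} {c′} {π = π} {d} conn e c∈S t∉S π-closed π-involutive d-flow d≗π =
    gen (s-flow , (λ z _ → s-into z) , s-onto , (λ z _ → s-into z)) (λ z z∉S → sym (s≗π z z∉S))
    where
    module r = Retraction (retract-list conn t∉S (allFin n))
    r-into : ∀ z → r.map z ∈ ∁ S
    r-into z = r.into z (∈-allFin z)
    -- The final collapse at c ∈ S is invisible outside S, but makes s a genuine element of S_Γ.
    s : Fin n → Fin n
    s = collapse c c′ ∘ d ∘ r.map
    s-flow : InFlow E s
    s-flow = InFlow-∘¹ (InFlow¹-∘ r.flow d-flow) (gen e (λ _ → refl))
    s≗π∘r : ∀ z → s z ≡ π (r.map z)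
    s≗π∘r z = trans (cong (collapse c c′) (d≗π _ (r-into z)))
      (collapse-≢ c′ (λ eq → x∈∁p⇒x∉p (π-closed _ (r-into z)) (subst (_∈ S) (sym eq) c∈S)))
    s≗π : ∀ z → z ∈ ∁ S → s z ≡ π z
    s≗π z z∉S = trans (s≗π∘r z) (cong π (r.fixes z z∉S))
    s-into : ∀ z → s z ∈ ∁ S
    s-into z = subst (_∈ ∁ S) (sym (s≗π∘r z)) (π-closed _ (r-into z))
    s-onto : ∀ w → w ∈ ∁ S → ∃ λ z → z ∈ ∁ S × s z ≡ w
    s-onto w w∉S = π w , π-closed w w∉S , trans (s≗π (π w) (π-closed w w∉S)) (π-involutive w w∉S)

  module PendantSwap {E : Rel n} (E-sym : Symmetric E) {L : ℕ → Fin n} {y : Fin n} {i l : ℕ}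
    (1≤i : 1 ≤ i) (i≤l : i ≤ l) (L-path : IsPath E L (i + l)) (y~Li : E y (L i))
    (y∉L : ∀ q → q ≤ i + l → y ≢ L q) where

    N : ℕ
    N = i + l

    L-distinct : Distinct L N
    L-distinct = distinct L-path

    L≢ : ∀ {p q} → p ≤ N → q ≤ N → p ≢ q → L p ≢ L q
    L≢ p≤N q≤N p≢q eq = p≢q (L-distinct p≤N q≤N eq)

    1+l≤N : suc l ≤ N
    1+l≤N = +-monoˡ-≤ l 1≤i

    i+t≤N : ∀ {t} → t ≤ l → i + t ≤ N
    i+t≤N = +-monoʳ-≤ i

    Y : ℕ → Fin n
    Y = prepend y (drop i L)

    Y-path : IsPath E Y (suc l)
    Y-path = IsPath-prepend (subst (E y ∘ L) (sym (+-identityʳ i)) y~Li)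
      (λ t t≤l → y∉L (i + t) (i+t≤N t≤l)) (IsPath-drop i L-path)

    Q : ℕ → Fin n
    Q = prepend y (reverse L i)

    Q-path : IsPath E Q (suc i)
    Q-path = IsPath-prepend y~Li (λ j _ → y∉L (i ∸ j) (≤-trans (m∸n≤m i j) (m≤m+n i l)))
      (IsPath-reverse E-sym (IsPath-≤ L-path (m≤m+n i l)))

    a : ℕ
    a = suc (suc (l ∸ i))

    a≤1+l : a ≤ suc l
    a≤1+l = s≤s (∸-monoʳ-< {l} {i} {0} 1≤i i≤l)

    i+1+[l∸i]≡1+l : i + suc (l ∸ i) ≡ suc l
    i+1+[l∸i]≡1+l = trans (+-suc i _) (cong suc (m+[n∸m]≡n i≤l))

    i+t≤1+l : ∀ {t} → t < a → i + t ≤ suc l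
    i+t≤1+l {t} (s≤s t≤) = subst (i + t ≤_) i+1+[l∸i]≡1+l (+-monoʳ-≤ i t≤)

    -- Tokens sit at L 0, at L N and (possibly) at L 1, …, L (i - 1); the vertices y, L i, …, L (N - 1)
    -- serve as free room.  The token from L N parks at y (σ₁), the block L 0, …, L (i - 1) moves up by
    -- l + 1 (σ₂), the parked token enters L 0 through y (σ₃), the token from L 0 parks at y (σ₄), the
    -- rest of the block moves back down (σ₅), and the parked token leaves for L N (σ₆).
    σ₁ σ₂ σ₃ σ₄ σ₅ σ₆ swap : Fin n → Fin n
    σ₁ = slide (reverse Y (suc l)) (suc l) ^ suc l
    σ₂ = slide L N ^ suc l
    σ₃ = slide Q (suc i) ^ suc i
    σ₄ = slide (reverse Y a) a ^ a
    σ₅ = slide (reverse L N) N ^ suc l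
    σ₆ = slide Y (suc l) ^ suc l
    swap = σ₆ ∘ σ₅ ∘ σ₄ ∘ σ₃ ∘ σ₂ ∘ σ₁

    swap-flow : InFlow¹ E swap
    swap-flow =
      flow (IsPath-reverse E-sym Y-path) (suc l) ⊙ flow L-path (suc l) ⊙ flow Q-path (suc i)
      ⊙ flow (IsPath-reverse E-sym (IsPath-≤ Y-path a≤1+l)) a ⊙ flow (IsPath-reverse E-sym L-path) (suc l)
      ⊙ flow Y-path (suc l)
      where
      flow : ∀ {f r} → IsPath E f r → ∀ k → InFlow¹ E (slide f r ^ k)
      flow f-path = InFlow¹-^ (slide-InFlow¹ (walk f-path))
      infixl 5 _⊙_
      _⊙_ : ∀ {s t} → InFlow¹ E s → InFlow¹ E t → InFlow¹ E (t ∘ s)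
      _⊙_ = InFlow¹-∘

    L0≢L[i+t] : ∀ {t} → i + t ≤ N → L 0 ≢ L (i + t)
    L0≢L[i+t] {t} i+t≤N = L≢ z≤n i+t≤N (<⇒≢ (≤-trans 1≤i (m≤m+n i t)))

    Y[a]≡L[1+l] : Y a ≡ L (suc l)
    Y[a]≡L[1+l] = cong L i+1+[l∸i]≡1+l

    swap-left : swap (L 0) ≡ L N
    swap-left = begin
      σ₆ (σ₅ (σ₄ (σ₃ (σ₂ (σ₁ (L 0))))))
        ≡⟨ cong (σ₆ ∘ σ₅ ∘ σ₄ ∘ σ₃ ∘ σ₂) (slide^-reverse-fixes (suc l) L0∉Y (suc l)) ⟩
      σ₆ (σ₅ (σ₄ (σ₃ (σ₂ (L 0)))))
        ≡⟨ cong (σ₆ ∘ σ₅ ∘ σ₄ ∘ σ₃) (slide^-advances L-distinct 0 (suc l) 1+l≤N) ⟩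
      σ₆ (σ₅ (σ₄ (σ₃ (L (suc l)))))
        ≡⟨ cong (σ₆ ∘ σ₅ ∘ σ₄) (slide^-fixes (suc i) L[1+l]∉Q (suc i)) ⟩
      σ₆ (σ₅ (σ₄ (L (suc l))))
        ≡⟨ cong (σ₆ ∘ σ₅ ∘ σ₄) (sym Y[a]≡L[1+l]) ⟩
      σ₆ (σ₅ (σ₄ (Y a)))
        ≡⟨ cong (σ₆ ∘ σ₅) (slide^-reverse-retreats (Distinct-≤ (distinct Y-path) a≤1+l) 0 a ≤-refl) ⟩
      σ₆ (σ₅ y)
        ≡⟨ cong σ₆ (slide^-reverse-fixes N (λ j _ j≤N → y∉L j j≤N) (suc l)) ⟩
      σ₆ y
        ≡⟨ slide^-advances (distinct Y-path) 0 (suc l) ≤-refl ⟩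
      L N ∎
      where
      open ≡-Reasoning
      L0∉Y : ∀ j → 0 < j → j ≤ suc l → L 0 ≢ Y j
      L0∉Y (suc t) _ (s≤s t≤l) = L0≢L[i+t] (i+t≤N t≤l)
      L[1+l]∉Q : ∀ j → j < suc i → L (suc l) ≢ Q j
      L[1+l]∉Q zero _ eq = y∉L (suc l) 1+l≤N (sym eq)
      L[1+l]∉Q (suc j) _ = L≢ 1+l≤N (≤-trans (m∸n≤m i j) (m≤m+n i l))
        (>⇒≢ (s≤s (≤-trans (m∸n≤m i j) i≤l)))

    swap-right : swap (L N) ≡ L 0
    swap-right = begin
      σ₆ (σ₅ (σ₄ (σ₃ (σ₂ (σ₁ (Y (suc l)))))))
        ≡⟨ cong (σ₆ ∘ σ₅ ∘ σ₄ ∘ σ₃ ∘ σ₂) (slide^-reverse-retreats (distinct Y-path) 0 (suc l) ≤-refl) ⟩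
      σ₆ (σ₅ (σ₄ (σ₃ (σ₂ y))))
        ≡⟨ cong (σ₆ ∘ σ₅ ∘ σ₄ ∘ σ₃) (slide^-fixes N (λ j j<N → y∉L j (<⇒≤ j<N)) (suc l)) ⟩
      σ₆ (σ₅ (σ₄ (σ₃ (Q 0))))
        ≡⟨ cong (σ₆ ∘ σ₅ ∘ σ₄) (slide^-advances (distinct Q-path) 0 (suc i) ≤-refl) ⟩
      σ₆ (σ₅ (σ₄ (L (i ∸ i))))
        ≡⟨ cong (σ₆ ∘ σ₅ ∘ σ₄ ∘ L) (n∸n≡0 i) ⟩
      σ₆ (σ₅ (σ₄ (L 0)))
        ≡⟨ cong (σ₆ ∘ σ₅) (slide^-reverse-fixes a L0∉Y[≤a] a) ⟩
      σ₆ (σ₅ (L 0))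
        ≡⟨ cong σ₆ (slide^-reverse-fixes N (λ j 0<j j≤N → L≢ z≤n j≤N (<⇒≢ 0<j)) (suc l)) ⟩
      σ₆ (L 0)
        ≡⟨ slide^-fixes (suc l) L0∉Y[<1+l] (suc l) ⟩
      L 0 ∎
      where
      open ≡-Reasoning
      L0∉Y[≤a] : ∀ j → 0 < j → j ≤ a → L 0 ≢ Y j
      L0∉Y[≤a] (suc t) _ t<a = L0≢L[i+t] (≤-trans (i+t≤1+l t<a) 1+l≤N)
      L0∉Y[<1+l] : ∀ j → j < suc l → L 0 ≢ Y j
      L0∉Y[<1+l] zero _ eq = y∉L 0 z≤n (sym eq)
      L0∉Y[<1+l] (suc t) (s≤s t<l) = L0≢L[i+t] (i+t≤N (<⇒≤ t<l))

    swap-middle : ∀ {p} → 0 < p → p < i → swap (L p) ≡ L p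
    swap-middle {p} 0<p p<i = begin
      σ₆ (σ₅ (σ₄ (σ₃ (σ₂ (σ₁ (L p))))))
        ≡⟨ cong (σ₆ ∘ σ₅ ∘ σ₄ ∘ σ₃ ∘ σ₂) (slide^-reverse-fixes (suc l) Lp∉Y[≤1+l] (suc l)) ⟩
      σ₆ (σ₅ (σ₄ (σ₃ (σ₂ (L p)))))
        ≡⟨ cong (σ₆ ∘ σ₅ ∘ σ₄ ∘ σ₃) (slide^-advances L-distinct p (suc l) p+1+l≤N) ⟩
      σ₆ (σ₅ (σ₄ (σ₃ (L (p + suc l)))))
        ≡⟨ cong (σ₆ ∘ σ₅ ∘ σ₄) (slide^-fixes (suc i) L[p+1+l]∉Q (suc i)) ⟩
      σ₆ (σ₅ (σ₄ (L (p + suc l))))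
        ≡⟨ cong (σ₆ ∘ σ₅) (slide^-reverse-fixes a L[p+1+l]∉Y a) ⟩
      σ₆ (σ₅ (L (p + suc l)))
        ≡⟨ cong σ₆ (slide^-reverse-retreats L-distinct p (suc l) p+1+l≤N) ⟩
      σ₆ (L p)
        ≡⟨ slide^-fixes (suc l) Lp∉Y[<1+l] (suc l) ⟩
      L p ∎
      where
      open ≡-Reasoning
      p≤N : p ≤ N
      p≤N = ≤-trans (<⇒≤ p<i) (m≤m+n i l)
      p+1+l≤N : p + suc l ≤ N
      p+1+l≤N = subst (_≤ N) (sym (+-suc p l)) (+-monoˡ-≤ l p<i)
      i<p+1+l : i < p + suc l
      i<p+1+l = ≤-trans (s≤s i≤l) (m≤n+m (suc l) p)
      Lp≢L[i+t] : ∀ {t} → i + t ≤ N → L p ≢ L (i + t)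
      Lp≢L[i+t] {t} i+t≤N = L≢ p≤N i+t≤N (<⇒≢ (<-≤-trans p<i (m≤m+n i t)))
      Lp∉Y[≤1+l] : ∀ j → 0 < j → j ≤ suc l → L p ≢ Y j
      Lp∉Y[≤1+l] (suc t) _ (s≤s t≤l) = Lp≢L[i+t] (i+t≤N t≤l)
      Lp∉Y[<1+l] : ∀ j → j < suc l → L p ≢ Y j
      Lp∉Y[<1+l] zero _ eq = y∉L p p≤N (sym eq)
      Lp∉Y[<1+l] (suc t) (s≤s t<l) = Lp≢L[i+t] (i+t≤N (<⇒≤ t<l))
      L[p+1+l]∉Q : ∀ j → j < suc i → L (p + suc l) ≢ Q j
      L[p+1+l]∉Q zero _ eq = y∉L (p + suc l) p+1+l≤N (sym eq)
      L[p+1+l]∉Q (suc j) _ = L≢ p+1+l≤N (≤-trans (m∸n≤m i j) (m≤m+n i l))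
        (>⇒≢ (≤-<-trans (m∸n≤m i j) i<p+1+l))
      L[p+1+l]∉Y : ∀ j → 0 < j → j ≤ a → L (p + suc l) ≢ Y j
      L[p+1+l]∉Y (suc t) _ t<a = L≢ p+1+l≤N (≤-trans (i+t≤1+l t<a) 1+l≤N)
        (>⇒≢ (≤-<-trans (i+t≤1+l t<a) (subst (suc l <_) (sym (+-suc p l)) (s≤s (+-monoˡ-≤ l 0<p)))))

    swap-off : ∀ {w} → w ≢ y → (∀ q → q ≤ N → w ≢ L q) → swap w ≡ w
    swap-off {w} w≢y w∉L = begin
      σ₆ (σ₅ (σ₄ (σ₃ (σ₂ (σ₁ w)))))
        ≡⟨ cong (σ₆ ∘ σ₅ ∘ σ₄ ∘ σ₃ ∘ σ₂) (slide^-reverse-fixes (suc l) (λ j _ → w∉Y j) (suc l)) ⟩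
      σ₆ (σ₅ (σ₄ (σ₃ (σ₂ w))))
        ≡⟨ cong (σ₆ ∘ σ₅ ∘ σ₄ ∘ σ₃) (slide^-fixes N (λ j j<N → w∉L j (<⇒≤ j<N)) (suc l)) ⟩
      σ₆ (σ₅ (σ₄ (σ₃ w)))
        ≡⟨ cong (σ₆ ∘ σ₅ ∘ σ₄) (slide^-fixes (suc i) w∉Q (suc i)) ⟩
      σ₆ (σ₅ (σ₄ w))
        ≡⟨ cong (σ₆ ∘ σ₅) (slide^-reverse-fixes a (λ j _ j≤a → w∉Y j (≤-trans j≤a a≤1+l)) a) ⟩
      σ₆ (σ₅ w)
        ≡⟨ cong σ₆ (slide^-reverse-fixes N (λ j _ → w∉L j) (suc l)) ⟩
      σ₆ w
        ≡⟨ slide^-fixes (suc l) (λ j j<1+l → w∉Y j (<⇒≤ j<1+l)) (suc l) ⟩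
      w ∎
      where
      open ≡-Reasoning
      w∉Y : ∀ j → j ≤ suc l → w ≢ Y j
      w∉Y zero _ = w≢y
      w∉Y (suc t) (s≤s t≤l) = w∉L (i + t) (i+t≤N t≤l)
      w∉Q : ∀ j → j < suc i → w ≢ Q j
      w∉Q zero _ = w≢y
      w∉Q (suc j) _ = w∉L (i ∸ j) (≤-trans (m∸n≤m i j) (m≤m+n i l))

    swap-agrees : ∀ w → w ≢ y → (∀ p → i ≤ p → p < N → w ≢ L p)
      → swap w ≡ transposition (L 0) (L N) w
    swap-agrees = transposition-elim (λ w t → w ≢ y → (∀ p → i ≤ p → p < N → w ≢ L p) → swap w ≡ t)
      (λ _ _ → swap-left) (λ _ _ → swap-right) fixed
      where
      fixed : ∀ {w} → w ≢ L 0 → w ≢ L N → w ≢ y → (∀ p → i ≤ p → p < N → w ≢ L p)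
        → swap w ≡ w
      fixed {w} w≢L0 w≢LN w≢y w∉L≥i with anyUpTo? (λ p → w ≟ L p) i
      ... | yes (p , p<i , refl) = swap-middle (n≢0⇒n>0 λ { refl → w≢L0 refl }) p<i
      ... | no w∉L<i = swap-off w≢y w∉L
        where
        w∉L : ∀ q → q ≤ N → w ≢ L q
        w∉L q q≤N with q <? i | m≤n⇒m<n∨m≡n q≤N
        ... | yes q<i | _ = λ eq → w∉L<i (q , q<i , eq)
        ... | no q≮i | inj₁ q<N = w∉L≥i q (≮⇒≥ q≮i) q<N
        ... | no _ | inj₂ refl = w≢LN

  module Spine {E : Rel n} (E-sym : Symmetric E) {m l i : ℕ} {y v : Fin n} {x u : ℕ → Fin n}
    (1≤i : 1 ≤ i) (i≤m : i ≤ m) (m≤l : m ≤ l)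
    (x-injective : ∀ a b → 1 ≤ a → a ≤ l → 1 ≤ b → b ≤ l → x a ≡ x b → a ≡ b)
    (u-injective : ∀ a b → 1 ≤ a → a ≤ m → 1 ≤ b → b ≤ m → u a ≡ u b → a ≡ b)
    (x≢u : ∀ a b → 1 ≤ a → a ≤ l → 1 ≤ b → b ≤ m → x a ≢ u b)
    (y,v≢x : ∀ j → 1 ≤ j → j ≤ l → (y ≢ x j) × (v ≢ x j))
    (y,v≢u : ∀ j → 1 ≤ j → j ≤ m → (y ≢ u j) × (v ≢ u j))
    (y≢v : y ≢ v)
    (x-walk : ∀ j → 1 ≤ j → j + 1 ≤ l → E (x j) (x (j + 1)))
    (x~v : E (x l) v)
    (x~u : E (x 1) (u 1))
    (u-walk : ∀ j → 1 ≤ j → j + 1 ≤ m → E (u j) (u (j + 1)))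
    where

    1≤l : 1 ≤ l
    1≤l = ≤-trans 1≤i (≤-trans i≤m m≤l)

    spine : ℕ → Fin n
    spine p with p <? i
    ... | yes _ = u (i ∸ p)
    ... | no _ with p <? i + l
    ...   | yes _ = x (suc (p ∸ i))
    ...   | no _ = v

    data SpineView (p : ℕ) : Fin n → Set where
      in-u : p < i → SpineView p (u (i ∸ p))
      in-x : i ≤ p → p < i + l → SpineView p (x (suc (p ∸ i)))
      at-v : p ≡ i + l → SpineView p v

    spine-view : ∀ {p} → p ≤ i + l → SpineView p (spine p)
    spine-view {p} p≤N with p <? i
    ... | yes p<i = in-u p<i
    ... | no p≮i with p <? i + l
    ...   | yes p<N = in-x (≮⇒≥ p≮i) p<N
    ...   | no p≮N = at-v (≤-antisym p≤N (≮⇒≥ p≮N))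

    1≤i∸p : ∀ {p} → p < i → 1 ≤ i ∸ p
    1≤i∸p = m<n⇒0<n∸m

    i∸p≤m : ∀ p → i ∸ p ≤ m
    i∸p≤m p = ≤-trans (m∸n≤m i p) i≤m

    1+p∸i≤l : ∀ {p} → i ≤ p → p < i + l → suc (p ∸ i) ≤ l
    1+p∸i≤l {p} i≤p p<N = subst (suc (p ∸ i) ≤_) (m+n∸m≡n i l) (∸-monoˡ-< p<N i≤p)

    spine-start : spine 0 ≡ u i
    spine-start with 0 <? i
    ... | yes _ = refl
    ... | no 0≮i = ⊥-elim (0≮i 1≤i)

    spine-end : spine (i + l) ≡ v
    spine-end with spine (i + l) | spine-view {i + l} ≤-refl
    ... | _ | in-u N<i = ⊥-elim (<-irrefl refl (<-≤-trans N<i (m≤m+n i l)))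
    ... | _ | in-x _ N<N = ⊥-elim (<-irrefl refl N<N)
    ... | _ | at-v _ = refl

    spine-interior : (P : Fin n → Set) → (∀ j → 1 ≤ j → j ≤ l → P (x j))
      → ∀ {p} → i ≤ p → p < i + l → P (spine p)
    spine-interior P Px {p} i≤p p<N with spine p | spine-view (<⇒≤ p<N)
    ... | _ | in-u p<i = ⊥-elim (<-irrefl refl (<-≤-trans p<i i≤p))
    ... | _ | in-x i≤p p<N = Px _ (s≤s z≤n) (1+p∸i≤l i≤p p<N)
    ... | _ | at-v refl = ⊥-elim (<-irrefl refl p<N)

    y∉spine : ∀ q → q ≤ i + l → y ≢ spine q
    y∉spine q q≤N with spine q | spine-view q≤N
    ... | _ | in-u q<i = proj₁ (y,v≢u _ (1≤i∸p q<i) (i∸p≤m q))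
    ... | _ | in-x i≤q q<N = proj₁ (y,v≢x _ (s≤s z≤n) (1+p∸i≤l i≤q q<N))
    ... | _ | at-v _ = y≢v

    spine-distinct : Distinct spine (i + l)
    spine-distinct {a} {b} a≤N b≤N eq with spine a | spine-view a≤N | spine b | spine-view b≤N
    ... | _ | in-u a<i | _ | in-u b<i =
      ∸-cancelˡ-≡ (<⇒≤ a<i) (<⇒≤ b<i) (u-injective _ _ (1≤i∸p a<i) (i∸p≤m a) (1≤i∸p b<i) (i∸p≤m b) eq)
    ... | _ | in-u a<i | _ | in-x i≤b b<N =
      ⊥-elim (x≢u _ _ (s≤s z≤n) (1+p∸i≤l i≤b b<N) (1≤i∸p a<i) (i∸p≤m a) (sym eq))
    ... | _ | in-u a<i | _ | at-v _ = ⊥-elim (proj₂ (y,v≢u _ (1≤i∸p a<i) (i∸p≤m a)) (sym eq))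
    ... | _ | in-x i≤a a<N | _ | in-u b<i =
      ⊥-elim (x≢u _ _ (s≤s z≤n) (1+p∸i≤l i≤a a<N) (1≤i∸p b<i) (i∸p≤m b) eq)
    ... | _ | in-x i≤a a<N | _ | in-x i≤b b<N = ∸-cancelʳ-≡ i≤a i≤b
      (suc-injective (x-injective _ _ (s≤s z≤n) (1+p∸i≤l i≤a a<N) (s≤s z≤n) (1+p∸i≤l i≤b b<N) eq))
    ... | _ | in-x i≤a a<N | _ | at-v _ = ⊥-elim (proj₂ (y,v≢x _ (s≤s z≤n) (1+p∸i≤l i≤a a<N)) (sym eq))
    ... | _ | at-v _ | _ | in-u b<i = ⊥-elim (proj₂ (y,v≢u _ (1≤i∸p b<i) (i∸p≤m b)) eq)
    ... | _ | at-v _ | _ | in-x i≤b b<N = ⊥-elim (proj₂ (y,v≢x _ (s≤s z≤n) (1+p∸i≤l i≤b b<N)) eq)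
    ... | _ | at-v a≡N | _ | at-v b≡N = trans a≡N (sym b≡N)

    x-step : ∀ j → 1 ≤ j → suc j ≤ l → E (x j) (x (suc j))
    x-step j 1≤j 1+j≤l = subst (E (x j) ∘ x) (+-comm j 1) (x-walk j 1≤j (subst (_≤ l) (+-comm 1 j) 1+j≤l))

    u-step : ∀ j → 1 ≤ j → suc j ≤ m → E (u j) (u (suc j))
    u-step j 1≤j 1+j≤m = subst (E (u j) ∘ u) (+-comm j 1) (u-walk j 1≤j (subst (_≤ m) (+-comm 1 j) 1+j≤m))

    spine-walk : IsWalk E spine (i + l)
    spine-walk j j<N with spine j | spine-view (<⇒≤ j<N) | spine (suc j) | spine-view j<N
    ... | _ | in-u j<i | _ | in-u 1+j<i =
      subst (λ q → E (u q) (u (i ∸ suc j))) (sym i∸j≡1+i∸[1+j])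
        (E-sym (u-step (i ∸ suc j) (1≤i∸p 1+j<i) (subst (_≤ m) i∸j≡1+i∸[1+j] (i∸p≤m j))))
      where
      i∸j≡1+i∸[1+j] : i ∸ j ≡ suc (i ∸ suc j)
      i∸j≡1+i∸[1+j] = +-∸-assoc 1 j<i
    ... | _ | in-u j<i | _ | in-x i≤1+j _ =
      subst₂ (λ p q → E (u p) (x (suc q))) (sym i∸j≡1) (sym 1+j∸i≡0) (E-sym x~u)
      where
      1+j≡i : suc j ≡ i
      1+j≡i = ≤-antisym j<i i≤1+j
      i∸j≡1 : i ∸ j ≡ 1
      i∸j≡1 = trans (cong (_∸ j) (sym 1+j≡i)) (m+n∸n≡m 1 j)
      1+j∸i≡0 : suc j ∸ i ≡ 0
      1+j∸i≡0 = trans (cong (suc j ∸_) (sym 1+j≡i)) (n∸n≡0 (suc j))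
    ... | _ | in-u j<i | _ | at-v 1+j≡N =
      ⊥-elim (<-irrefl refl (<-≤-trans (m<m+n i 1≤l) (subst (_≤ i) 1+j≡N j<i)))
    ... | _ | in-x i≤j _ | _ | in-u 1+j<i = ⊥-elim (<-irrefl refl (<-≤-trans 1+j<i (m≤n⇒m≤1+n i≤j)))
    ... | _ | in-x i≤j _ | _ | in-x _ 1+j<N =
      subst (E (x (suc (j ∸ i))) ∘ x) (cong suc (sym 1+j∸i≡1+[j∸i]))
        (x-step (suc (j ∸ i)) (s≤s z≤n)
          (subst (_≤ l) (cong suc 1+j∸i≡1+[j∸i]) (1+p∸i≤l (m≤n⇒m≤1+n i≤j) 1+j<N)))
      where
      1+j∸i≡1+[j∸i] : suc j ∸ i ≡ suc (j ∸ i)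
      1+j∸i≡1+[j∸i] = +-∸-assoc 1 i≤j
    ... | _ | in-x i≤j _ | _ | at-v 1+j≡N = subst (λ q → E (x q) v) (sym 1+j∸i≡l) x~v
      where
      1+j∸i≡l : suc (j ∸ i) ≡ l
      1+j∸i≡l = trans (sym (+-∸-assoc 1 i≤j)) (trans (cong (_∸ i) 1+j≡N) (m+n∸m≡n i l))
    ... | _ | at-v j≡N | _ | _ = ⊥-elim (<-irrefl j≡N j<N)

    spine-path : IsPath E spine (i + l)
    spine-path = record { walk = spine-walk ; distinct = spine-distinct }

    spine-pendant : spine i ≡ x 1
    spine-pendant with spine i | spine-view (m≤m+n i l)
    ... | _ | in-u i<i = ⊥-elim (<-irrefl refl i<i)
    ... | _ | in-x _ _ = cong (x ∘ suc) (n∸n≡0 i)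
    ... | _ | at-v i≡N = ⊥-elim (<-irrefl refl
      (subst (i <_) (sym i≡N) (m<m+n i 1≤l)))

lemma5p2 : (n m l k : ℕ) → 1 ≤ m → m ≤ l → l < k → k + 2 ≤ n
    → (E : Rel n) → IsSimpleGraph E → Connected E
    → (y v : Fin n) (x u : ℕ → Fin n)
    → (∀ i j → 1 ≤ i → i ≤ l → 1 ≤ j → j ≤ l → x i ≡ x j → i ≡ j)
    → (∀ i j → 1 ≤ i → i ≤ m → 1 ≤ j → j ≤ m → u i ≡ u j → i ≡ j)
    → (∀ i j → 1 ≤ i → i ≤ l → 1 ≤ j → j ≤ m → x i ≢ u j)
    → (∀ i → 1 ≤ i → i ≤ l → (y ≢ x i) × (v ≢ x i))
    → (∀ j → 1 ≤ j → j ≤ m → (y ≢ u j) × (v ≢ u j))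
    → y ≢ v
    → E y (x 1)
    → (∀ j → 1 ≤ j → j + 1 ≤ l → E (x j) (x (j + 1)))
    → E (x l) v
    → E (x 1) (u 1)
    → (∀ j → 1 ≤ j → j + 1 ≤ m → E (u j) (u (j + 1)))
    → (Vk : Subset n) → ∣ Vk ∣ ≡ k
    → y ∈ Vk → (∀ j → 1 ≤ j → j ≤ l → x j ∈ Vk)
    → v ∉ Vk
    → (i : ℕ) → 1 ≤ i → i ≤ m → u i ∉ Vk
    → InDefectGroup E Vk (transposition (u i) v)
lemma5p2 n m l k _ m≤l _ _ E Γ conn y v x u x-inj u-inj x≢u y,v≢x y,v≢u y≢v y~x₁ x-walk x~v x~u u-walk
  Vk _ y∈Vk x∈Vk v∉Vk i 1≤i i≤m uᵢ∉Vk =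
  involution∈DefectGroup conn y~x₁ y∈Vk v∉ (transposition-closed (∁ Vk) uᵢ∉ v∉)
    (λ w _ → transposition-involutive (u i) v w) swap-flow swap≗transposition
  where
  open Spine (IsSimpleGraph.sym Γ) 1≤i i≤m m≤l x-inj u-inj x≢u y,v≢x y,v≢u y≢v x-walk x~v x~u u-walk
  open PendantSwap (IsSimpleGraph.sym Γ) 1≤i (≤-trans i≤m m≤l) spine-path
    (subst (E y) (sym spine-pendant) y~x₁) y∉spine
  v∉ : v ∈ ∁ Vk
  v∉ = x∉p⇒x∈∁p v∉Vk
  uᵢ∉ : u i ∈ ∁ Vk
  uᵢ∉ = x∉p⇒x∈∁p uᵢ∉Vk
  swap≗transposition : ∀ w → w ∈ ∁ Vk → swap w ≡ transposition (u i) v w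
  swap≗transposition w w∉Vk = subst₂ (λ a b → swap w ≡ transposition a b w) spine-start spine-end
    (swap-agrees w (λ { refl → x∈∁p⇒x∉p w∉Vk y∈Vk })
      (λ p i≤p p<N w≡ → x∈∁p⇒x∉p w∉Vk
        (subst (_∈ Vk) (sym w≡) (spine-interior (_∈ Vk) x∈Vk i≤p p<N))))
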